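{- For every finite graph $G$, $\iota_{\rm g}(G)\le \gamma_{\rm g}(G)$.
   Context: All graphs are finite and simple; $N[S]$ denotes the closed neighborhood of a vertex set $S$. For a family $\mathcal{F}$ of graphs, a graph is $\mathcal{F}$-forbidden if it contains no member of $\mathcal{F}$ as a subgraph. In the $\mathcal{F}$-isolation game on $G$, Dominator and Staller alternately choose vertices of $G$, Dominator first; if $S$ is the set of already chosen vertices, a vertex $x$ may be chosen only if it dominates (equals or is adjacent to) some vertex $y$ lying in a component of $G-N[S]$ that is not $\mathcal{F}$-forbidden. The game ends when no such vertex exists. Dominator wants to minimize the number of chosen vertices, Staller wants to maximize it; $\iota_{\rm g}(G,\mathcal{F})$ is the number of chosen vertices under optimal play. Here $\iota_{\rm g}(G)=\iota_{\rm g}(G,\{K_2\})$ (the game isolation number) and $\gamma_{\rm g}(G)=\iota_{\rm g}(G,\{K_1\})$ (the game domination number). -}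

module Defs where

open import Data.Nat using (ℕ; zero; suc)
open import Data.Fin using (Fin; zero; suc)
open import Data.Bool using (Bool; true; false; T)
open import Data.List using (List; []; _∷_)
open import Data.List.Membership.Propositional using (_∈_)
open import Data.List.Relation.Unary.Any using (Any)
open import Data.Product using (Σ; ∃; _×_; _,_)
open import Data.Sum using (_⊎_)
open import Relation.Nullary using (¬_)
open import Relation.Binary.PropositionalEquality using (_≡_; refl)
open import Function.Definitions using (Injective)

record Graph : Set where
  field
    size       : ℕ
    adj        : Fin size → Fin size → Bool
    adj-sym    : ∀ x y → adj x y ≡ adj y x
    adj-irrefl : ∀ x → adj x x ≡ false
open Graph public

Vertex : Graph → Set
Vertex G = Fin (size G)

Edge : (G : Graph) → Vertex G → Vertex G → Set
Edge G x y = T (adj G x y)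

Dominates : (G : Graph) → Vertex G → Vertex G → Set
Dominates G x y = x ≡ y ⊎ Edge G x y

InClosedNbhd : (G : Graph) → List (Vertex G) → Vertex G → Set
InClosedNbhd G S y = ∃ λ s → s ∈ S × Dominates G s y

-- Reach G S y z : y and z are vertices of G - N[S] and z lies in the
-- component of G - N[S] containing y.
data Reach (G : Graph) (S : List (Vertex G)) (y : Vertex G) : Vertex G → Set where
  here : ¬ InClosedNbhd G S y → Reach G S y y
  step : ∀ {u v} → Reach G S y u → ¬ InClosedNbhd G S v → Edge G u v → Reach G S y v

ContainsSubgraph : (G : Graph) → (Vertex G → Set) → Graph → Set
ContainsSubgraph G C H =
  Σ (Vertex H → Vertex G) λ f →
    Injective _≡_ _≡_ f × (∀ i → C (f i)) × (∀ i j → Edge H i j → Edge G (f i) (f j))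

NotForbidden : (G : Graph) → List Graph → (Vertex G → Set) → Set
NotForbidden G F C = Any (ContainsSubgraph G C) F

Legal : (G : Graph) → List Graph → List (Vertex G) → Vertex G → Set
Legal G F S x =
  ∃ λ y → Dominates G x y × ¬ InClosedNbhd G S y × NotForbidden G F (Reach G S y)

data Player : Set where
  dominator staller : Player

-- Dominator has a strategy ensuring that from position (S, player to move)
-- at most k further vertices are chosen.
data DomCanLimit (G : Graph) (F : List Graph) : List (Vertex G) → Player → ℕ → Set where
  over  : ∀ {S p k} → (∀ x → ¬ Legal G F S x) → DomCanLimit G F S p k
  dmove : ∀ {S k} x → Legal G F S x → DomCanLimit G F (x ∷ S) staller k →
          DomCanLimit G F S dominator (suc k)
  smove : ∀ {S k} → (∀ x → Legal G F S x → DomCanLimit G F (x ∷ S) dominator k) →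
          DomCanLimit G F S staller (suc k)

-- Staller has a strategy ensuring that from position (S, player to move)
-- at least k further vertices are chosen.
data StaCanForce (G : Graph) (F : List Graph) : List (Vertex G) → Player → ℕ → Set where
  start : ∀ {S p} → StaCanForce G F S p zero
  smove : ∀ {S k} x → Legal G F S x → StaCanForce G F (x ∷ S) dominator k →
          StaCanForce G F S staller (suc k)
  dmove : ∀ {S k} → (∃ λ x → Legal G F S x) →
          (∀ x → Legal G F S x → StaCanForce G F (x ∷ S) staller k) →
          StaCanForce G F S dominator (suc k)

-- k is the number of chosen vertices under optimal play of the F-isolation
-- game on G (Dominator first): Dominator can keep it ≤ k, Staller can force ≥ k.
IsGameValue : Graph → List Graph → ℕ → Set
IsGameValue G F k = DomCanLimit G F [] dominator k × StaCanForce G F [] dominator k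

K1 : Graph
K1 = record { size = 1 ; adj = λ _ _ → false
            ; adj-sym = λ _ _ → refl ; adj-irrefl = λ _ → refl }

K2adj : Fin 2 → Fin 2 → Bool
K2adj zero zero = false
K2adj zero (suc zero) = true
K2adj (suc zero) zero = true
K2adj (suc zero) (suc zero) = false

K2sym : ∀ x y → K2adj x y ≡ K2adj y x
K2sym zero zero = refl
K2sym zero (suc zero) = refl
K2sym (suc zero) zero = refl
K2sym (suc zero) (suc zero) = refl

K2irr : ∀ x → K2adj x x ≡ false
K2irr zero = refl
K2irr (suc zero) = refl

K2 : Graph
K2 = record { size = 2 ; adj = K2adj ; adj-sym = K2sym ; adj-irrefl = K2irr }

IsGameIsolationNumber : Graph → ℕ → Set
IsGameIsolationNumber G k = IsGameValue G (K2 ∷ []) k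

IsGameDominationNumber : Graph → ℕ → Set
IsGameDominationNumber G k = IsGameValue G (K1 ∷ []) k

{-# OPTIONS --safe #-}
-- Dominator plays the isolation game while imagining a domination game on the
-- side, in which he follows an optimal domination strategy. The invariant is
-- that every vertex dominated in the imagined game is dominated or isolated in
-- the real one. Hence each real Staller move is legal in the imagined game, and
-- when an imagined Dominator move is illegal in the real game he may play any
-- legal move instead without breaking the invariant. The real game therefore
-- ends no later than the imagined one. Game values exist because every legal
-- move dominates a new vertex, so the game tree is finite.
module Submission where

open import Defs
open import Data.Nat using (ℕ; _≤_)
open import Data.Product using (Σ; _×_)

open import Data.Nat using (zero; suc; _<_; z≤n; s≤s)
open import Data.Nat.Induction using (<-wellFounded)
open import Data.Nat.Properties using (≤-totalOrder)
open import Data.Fin using (Fin; zero; suc; _≟_)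
open import Data.Fin.Properties using (any?)
open import Data.Bool using (T)
open import Data.Bool.Properties using (T?)
open import Data.List using (List; []; _∷_; length; filter; allFin)
open import Data.List.Extrema ≤-totalOrder
  using (argmin; argmax; argmin-all; argmax-all; f[argmin]≤f[xs]; f[xs]≤f[argmax])
open import Data.List.Membership.Propositional using (_∈_; find; lose)
open import Data.List.Membership.Propositional.Properties using (∈-filter⁺; ∈-allFin)
open import Data.List.Properties using (filter-notAll)
import Data.List.Relation.Unary.All as All
open import Data.List.Relation.Unary.All.Properties using (all-filter)
open import Data.List.Relation.Unary.Any using (here; there)
import Data.List.Relation.Unary.Any as Any
open import Data.Product using (∃; _,_; proj₁; proj₂)
open import Data.Sum using (_⊎_; inj₁; inj₂)
open import Data.Unit using (tt)
open import Function.Bundles using (_⇔_; mk⇔; module Equivalence)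
import Function.Properties.Equivalence as ⇔
open import Induction.WellFounded using (WellFounded; Acc; acc)
import Relation.Binary.Construct.On as On
open import Relation.Binary.PropositionalEquality using (_≡_; refl; sym; subst)
open import Relation.Nullary using (¬_; Dec; yes; no; contradiction)
open import Relation.Nullary.Decidable using (_×-dec_; _⊎-dec_; ¬?; map′)
import Relation.Nullary.Decidable as Dec
open import Relation.Unary using (Pred; Decidable; _⊆_)

module _ {n p} {P : Pred (Fin n) p} (P? : Decidable P) (f : Fin n → ℕ) where

  private
    candidates : List (Fin n)
    candidates = filter P? (allFin n)

    ∈-candidates : ∀ {x} → P x → x ∈ candidates
    ∈-candidates {x} px = ∈-filter⁺ P? (∈-allFin x) px

  minimizer : ∃ P → ∃ λ x* → P x* × (∀ x → P x → f x* ≤ f x)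
  minimizer (x₀ , px₀) =
    x* , argmin-all f px₀ (all-filter P? (allFin n)) ,
    λ x px → All.lookup (f[argmin]≤f[xs] x₀ candidates) (∈-candidates px)
    where x* = argmin f x₀ candidates

  maximizer : ∃ P → ∃ λ x* → P x* × (∀ x → P x → f x ≤ f x*)
  maximizer (x₀ , px₀) =
    x* , argmax-all f px₀ (all-filter P? (allFin n)) ,
    λ x px → All.lookup (f[xs]≤f[argmax] x₀ candidates) (∈-candidates px)
    where x* = argmax f x₀ candidates

module _ (G : Graph) where

  edge-sym : ∀ {x y} → Edge G x y → Edge G y x
  edge-sym {x} {y} = subst T (adj-sym G x y)

  edge-irrefl : ∀ {x} → ¬ Edge G x x
  edge-irrefl {x} = subst T (adj-irrefl G x)

  dominates? : ∀ x y → Dec (Dominates G x y)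
  dominates? x y = x ≟ y ⊎-dec T? (adj G x y)

  inClosedNbhd? : ∀ S y → Dec (InClosedNbhd G S y)
  inClosedNbhd? S y =
    map′ find (λ (s , s∈S , d) → lose s∈S d) (Any.any? (λ s → dominates? s y) S)

  inClosedNbhd-∷ : ∀ {x S y} → InClosedNbhd G S y → InClosedNbhd G (x ∷ S) y
  inClosedNbhd-∷ (s , s∈S , d) = s , there s∈S , d

  dominates⇒inClosedNbhd : ∀ {x S y} → Dominates G x y → InClosedNbhd G (x ∷ S) y
  dominates⇒inClosedNbhd {x} d = x , here refl , d

  Undominated : List (Vertex G) → Pred (Vertex G) _
  Undominated S y = ¬ InClosedNbhd G S y

  NonIsolated : List (Vertex G) → Pred (Vertex G) _
  NonIsolated S y = Undominated S y × ∃ λ w → Edge G y w × Undominated S w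

  Settled : List (Vertex G) → Pred (Vertex G) _
  Settled S y = ¬ NonIsolated S y

  nonIsolated? : ∀ S y → Dec (NonIsolated S y)
  nonIsolated? S y =
    ¬? (inClosedNbhd? S y) ×-dec any? (λ w → T? (adj G y w) ×-dec ¬? (inClosedNbhd? S w))

  undominated-∷ : ∀ {x S y} → Undominated (x ∷ S) y → Undominated S y
  undominated-∷ ¬dy dy = ¬dy (inClosedNbhd-∷ dy)

  nonIsolated-∷ : ∀ {x S y} → NonIsolated (x ∷ S) y → NonIsolated S y
  nonIsolated-∷ (¬dy , w , e , ¬dw) = undominated-∷ ¬dy , w , e , undominated-∷ ¬dw

  settled-∷ : ∀ {x S y} → Settled S y → Settled (x ∷ S) y
  settled-∷ settled nonIso = settled (nonIsolated-∷ nonIso)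

  -- Built by successive filtering so that each move visibly shortens the list.
  undominated : List (Vertex G) → List (Vertex G)
  undominated []      = allFin (size G)
  undominated (x ∷ S) = filter (λ y → ¬? (dominates? x y)) (undominated S)

  ∈-undominated : ∀ {S y} → Undominated S y → y ∈ undominated S
  ∈-undominated {[]}    {y} _   = ∈-allFin y
  ∈-undominated {x ∷ S} {y} ¬dy =
    ∈-filter⁺ (λ y → ¬? (dominates? x y)) (∈-undominated (undominated-∷ ¬dy))
      (λ d → ¬dy (dominates⇒inClosedNbhd d))

  undominated-shrinks : ∀ {S x y} → Dominates G x y → Undominated S y →
                        length (undominated (x ∷ S)) < length (undominated S)
  undominated-shrinks {x = x} d ¬dy =
    filter-notAll (λ y → ¬? (dominates? x y)) _ (lose (∈-undominated ¬dy) (λ ¬d → ¬d d))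

  reach-undominated : ∀ {S y u} → Reach G S y u → Undominated S u
  reach-undominated (Reach.here ¬du)     = ¬du
  reach-undominated (Reach.step _ ¬dv _) = ¬dv

  reach⇒≡⊎nonIsolated : ∀ {S y u} → Reach G S y u → u ≡ y ⊎ NonIsolated S y
  reach⇒≡⊎nonIsolated (Reach.here _) = inj₁ refl
  reach⇒≡⊎nonIsolated (Reach.step {v = v} r ¬dv e) with reach⇒≡⊎nonIsolated r
  ... | inj₁ refl   = inj₂ (reach-undominated r , v , e , ¬dv)
  ... | inj₂ nonIso = inj₂ nonIso

  undominated⇒containsK1 : ∀ {S y} → Undominated S y → ContainsSubgraph G (Reach G S y) K1
  undominated⇒containsK1 {y = y} ¬dy =
    (λ _ → y) , (λ { {zero} {zero} _ → refl }) , (λ _ → Reach.here ¬dy) , λ _ _ ()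

  containsK2⇒nonIsolated : ∀ {S y} → ContainsSubgraph G (Reach G S y) K2 → NonIsolated S y
  containsK2⇒nonIsolated (f , _ , inC , edge) with reach⇒≡⊎nonIsolated (inC zero)
  ... | inj₁ refl   =
    reach-undominated (inC zero) , f (suc zero) , edge zero (suc zero) tt ,
    reach-undominated (inC (suc zero))
  ... | inj₂ nonIso = nonIso

  nonIsolated⇒containsK2 : ∀ {S y} → NonIsolated S y → ContainsSubgraph G (Reach G S y) K2
  nonIsolated⇒containsK2 {S} {y} (¬dy , w , e , ¬dw) = f , f-injective , inC , edge
    where
    f : Fin 2 → Vertex G
    f zero       = y
    f (suc zero) = w

    f-injective : ∀ {i j} → f i ≡ f j → i ≡ j
    f-injective {zero}     {zero}     _   = refl
    f-injective {zero}     {suc zero} y≡w = contradiction (subst (Edge G y) (sym y≡w) e) edge-irrefl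
    f-injective {suc zero} {zero}     w≡y = contradiction (subst (Edge G y) w≡y e) edge-irrefl
    f-injective {suc zero} {suc zero} _   = refl

    inC : ∀ i → Reach G S y (f i)
    inC zero       = Reach.here ¬dy
    inC (suc zero) = Reach.step (Reach.here ¬dy) ¬dw e

    edge : ∀ i j → Edge K2 i j → Edge G (f i) (f j)
    edge zero       (suc zero) _ = e
    edge (suc zero) zero       _ = edge-sym e
    edge zero       zero       ()
    edge (suc zero) (suc zero) ()

  legal-K1⇔ : ∀ {S x} → Legal G (K1 ∷ []) S x ⇔ ∃ λ y → Dominates G x y × Undominated S y
  legal-K1⇔ = mk⇔ (λ (y , d , ¬dy , _) → y , d , ¬dy)
                  (λ (y , d , ¬dy) → y , d , ¬dy , here (undominated⇒containsK1 ¬dy))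

  legal-K2⇔ : ∀ {S x} → Legal G (K2 ∷ []) S x ⇔ ∃ λ y → Dominates G x y × NonIsolated S y
  legal-K2⇔ = mk⇔ (λ { (y , d , _ , here H) → y , d , containsK2⇒nonIsolated H })
                  (λ (y , d , nonIso) → y , d , proj₁ nonIso , here (nonIsolated⇒containsK2 nonIso))

  legal-K1? : ∀ S x → Dec (Legal G (K1 ∷ []) S x)
  legal-K1? S x = Dec.map (⇔.sym legal-K1⇔)
    (any? (λ y → dominates? x y ×-dec ¬? (inClosedNbhd? S y)))

  legal-K2? : ∀ S x → Dec (Legal G (K2 ∷ []) S x)
  legal-K2? S x = Dec.map (⇔.sym legal-K2⇔)
    (any? (λ y → dominates? x y ×-dec nonIsolated? S y))

  module _ {F : List Graph} where

    IsValueAt : List (Vertex G) → Player → ℕ → Set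
    IsValueAt S p k = DomCanLimit G F S p k × StaCanForce G F S p k

    staCanForce-lower : ∀ {S p j k} → j ≤ k → StaCanForce G F S p k → StaCanForce G F S p j
    staCanForce-lower {j = zero}  _         _               = start
    staCanForce-lower {j = suc j} (s≤s j≤k) (smove x l s)  = smove x l (staCanForce-lower j≤k s)
    staCanForce-lower {j = suc j} (s≤s j≤k) (dmove some s) =
      dmove some (λ x l → staCanForce-lower j≤k (s x l))

    domCanLimit-raise : ∀ {S p j k} → j ≤ k → DomCanLimit G F S p j → DomCanLimit G F S p k
    domCanLimit-raise _         (over stuck)  = over stuck
    domCanLimit-raise (s≤s j≤k) (dmove x l d) = dmove x l (domCanLimit-raise j≤k d)
    domCanLimit-raise (s≤s j≤k) (smove d)     = smove (λ x l → domCanLimit-raise j≤k (d x l))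

    forced≤limited : ∀ {S p a b} → StaCanForce G F S p a → DomCanLimit G F S p b → a ≤ b
    forced≤limited start             _             = z≤n
    forced≤limited (smove x l s)     (over stuck)  = contradiction l (stuck x)
    forced≤limited (smove x l s)     (smove d)     = s≤s (forced≤limited s (d x l))
    forced≤limited (dmove (x , l) _) (over stuck)  = contradiction l (stuck x)
    forced≤limited (dmove _ s)       (dmove x l d) = s≤s (forced≤limited (s x l) d)

    _≺_ : List (Vertex G) → List (Vertex G) → Set
    T ≺ S = length (undominated T) < length (undominated S)

    ≺-wellFounded : WellFounded _≺_
    ≺-wellFounded = On.wellFounded (λ S → length (undominated S)) <-wellFounded

    legal⇒≺ : ∀ {S x} → Legal G F S x → (x ∷ S) ≺ S
    legal⇒≺ (_ , d , ¬dy , _) = undominated-shrinks d ¬dy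

    module _ (legal? : ∀ S x → Dec (Legal G F S x)) where

      module _ {S} (next : ∀ q x → Legal G F S x → ∃ (IsValueAt (x ∷ S) q)) where

        -- The value after a move is read off a canonical legality proof, so that
        -- it is a function of the move alone; illegal moves get the junk value 0.
        after : Player → Vertex G → ℕ
        after q x with legal? S x
        ... | yes l = proj₁ (next q x l)
        ... | no _  = 0

        after-isValue : ∀ q {x} → Legal G F S x → IsValueAt (x ∷ S) q (after q x)
        after-isValue q {x} l with legal? S x
        ... | yes l′ = proj₂ (next q x l′)
        ... | no ¬l  = contradiction l ¬l

        minimaxStep : ∀ p → ∃ (Legal G F S) → ∃ (IsValueAt S p)
        minimaxStep dominator some with minimizer (legal? S) (after staller) some
        ... | x* , l* , least =
          suc (after staller x*) ,
          dmove x* l* (proj₁ (after-isValue staller l*)) ,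
          dmove some (λ x l → staCanForce-lower (least x l) (proj₂ (after-isValue staller l)))
        minimaxStep staller some with maximizer (legal? S) (after dominator) some
        ... | x* , l* , greatest =
          suc (after dominator x*) ,
          smove (λ x l → domCanLimit-raise (greatest x l) (proj₁ (after-isValue dominator l))) ,
          smove x* l* (proj₂ (after-isValue dominator l*))

      valueFrom : ∀ S → Acc _≺_ S → ∀ p → ∃ (IsValueAt S p)
      valueFrom S (acc rec) p with any? (legal? S)
      ... | no stuck = 0 , over (λ x l → stuck (x , l)) , start
      ... | yes some = minimaxStep (λ q x l → valueFrom (x ∷ S) (rec (legal⇒≺ l)) q) p some

      gameValue : ∃ (IsGameValue G F)
      gameValue = valueFrom [] (≺-wellFounded []) dominator

  legal-K2⇒legal-K1 : ∀ {T S x} → InClosedNbhd G T ⊆ Settled S →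
                      Legal G (K2 ∷ []) S x → Legal G (K1 ∷ []) T x
  legal-K2⇒legal-K1 covered l with Equivalence.to legal-K2⇔ l
  ... | y , d , nonIso = Equivalence.from legal-K1⇔ (y , d , λ dy → covered dy nonIso)

  dominates⇒settled : ∀ {x S y} → Dominates G x y → Settled (x ∷ S) y
  dominates⇒settled d (¬dy , _) = ¬dy (dominates⇒inClosedNbhd d)

  illegal⇒settled : ∀ {x x′ S y} → ¬ Legal G (K2 ∷ []) S x → Dominates G x y → Settled (x′ ∷ S) y
  illegal⇒settled ¬l d nonIso = ¬l (Equivalence.from legal-K2⇔ (_ , d , nonIsolated-∷ nonIso))

  settled-extend : ∀ {x x′ T S} → InClosedNbhd G T ⊆ Settled S →
                   (∀ {y} → Dominates G x y → Settled (x′ ∷ S) y) →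
                   InClosedNbhd G (x ∷ T) ⊆ Settled (x′ ∷ S)
  settled-extend covered new (_ , here refl , d)  = new d
  settled-extend covered new (s , there s∈T , d) = settled-∷ (covered (s , s∈T , d))

  imitate : ∀ {T S p k} → InClosedNbhd G T ⊆ Settled S →
            DomCanLimit G (K1 ∷ []) T p k → DomCanLimit G (K2 ∷ []) S p k
  imitate covered (over stuck) = over (λ x l → stuck x (legal-K2⇒legal-K1 covered l))
  imitate {S = S} covered (dmove x _ next) with legal-K2? S x
  ... | yes l = dmove x l (imitate (settled-extend covered dominates⇒settled) next)
  ... | no ¬l with any? (legal-K2? S)
  ...   | yes (x′ , l′) = dmove x′ l′ (imitate (settled-extend covered (illegal⇒settled ¬l)) next)
  ...   | no stuck      = over (λ x l → stuck (x , l))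
  imitate covered (smove next) =
    smove (λ x l → imitate (settled-extend covered dominates⇒settled)
                           (next x (legal-K2⇒legal-K1 covered l)))

corollary2p6 : (G : Graph) →
    Σ ℕ λ i → Σ ℕ λ g →
      IsGameIsolationNumber G i × IsGameDominationNumber G g × i ≤ g
corollary2p6 G with gameValue G (legal-K2? G) | gameValue G (legal-K1? G)
... | i , isoLimit , isoForce | g , domLimit , domForce =
  i , g , (isoLimit , isoForce) , (domLimit , domForce) ,
  forced≤limited G isoForce (imitate G (λ { (_ , () , _) }) domLimit)
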